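{- Let $p$ be an odd prime, $n,d$ positive integers with $nd$ even, $q=p^n$, and $q_0:=p^{\frac{nd}{2}}=q^{\frac d2}$. Let $\psi:\mathbb{F}_{q_0}^2\to\mathbb{F}_q^d$ be an $\mathbb{F}_p$-linear isomorphism and set $U:=\psi(\{(t,t^2):t\in\mathbb{F}_{q_0}\})\subset\mathbb{F}_q^d$. Then $|U|=q^{\frac d2}$ and $\Lambda_4(U)\le 2|U|^2$. In particular, $U$ is a $(4,\tfrac12)$-Salem set.
   Context: For finite $A\subset\mathbb{F}_q^d$, $\Lambda_4(A):=|\{(x_1,x_2,x_3,x_4)\in A^4:x_1+x_2=x_3+x_4\}|$. $A$ is a $(4,s)$-Salem set if $\Lambda_4(A)\le C\big(|A|^{4-4s}+|A|^4/q^d\big)$ for a constant $C$ independent of $q$ and $A$. -}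

module Defs where

open import Data.Nat as ℕ using (ℕ; zero; suc)
open import Data.Bool using (Bool; true; false; _∧_; if_then_else_)
open import Data.Product using (Σ; _×_; _,_)
open import Data.List using (List; []; _∷_; length; concatMap; map)
open import Data.Bool.ListAction using (any)
open import Data.List.Membership.Propositional using (_∈_)
open import Data.List.Relation.Unary.Unique.Propositional using (Unique)
open import Data.Vec as Vec using (Vec; []; _∷_; zipWith)
import Data.Vec.Properties as VecP
open import Relation.Nullary using (¬_; does)
open import Relation.Binary.Definitions using (DecidableEquality)
open import Relation.Binary.PropositionalEquality using (_≡_)
open import Algebra.Core using (Op₁; Op₂)
open import Algebra.Structures using (IsCommutativeRing)

record FiniteField : Set₁ where
  infixl 7 _*_
  infixl 6 _+_
  field
    Carrier : Set
    _≟_     : DecidableEquality Carrier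
    _+_     : Op₂ Carrier
    _*_     : Op₂ Carrier
    -_      : Op₁ Carrier
    0#      : Carrier
    1#      : Carrier
    isCommutativeRing : IsCommutativeRing _≡_ _+_ _*_ -_ 0# 1#
    0≢1     : ¬ (0# ≡ 1#)
    inverse : ∀ x → ¬ (x ≡ 0#) → Σ Carrier (λ y → x * y ≡ 1#)
    elems    : List Carrier
    complete : ∀ x → x ∈ elems
    unique   : Unique elems

  card : ℕ
  card = length elems

  -- action of the prime field F_p ⊆ F: k · x = x + ... + x (k times)
  _·_ : ℕ → Carrier → Carrier
  zero  · x = 0#
  suc k · x = x + k · x

  _+ᵛ_ : ∀ {d} → Vec Carrier d → Vec Carrier d → Vec Carrier d
  _+ᵛ_ = zipWith _+_

  _·ᵛ_ : ∀ {d} → ℕ → Vec Carrier d → Vec Carrier d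
  k ·ᵛ v = Vec.map (k ·_) v

  _≟ᵛ_ : ∀ {d} → DecidableEquality (Vec Carrier d)
  _≟ᵛ_ = VecP.≡-dec _≟_

  allVecs : (d : ℕ) → List (Vec Carrier d)
  allVecs zero    = [] ∷ []
  allVecs (suc d) = concatMap (λ x → map (x ∷_) (allVecs d)) elems

  countL : {X : Set} → (X → Bool) → List X → ℕ
  countL P []       = 0
  countL P (x ∷ xs) = (if P x then 1 else 0) ℕ.+ countL P xs

  sumL : {X : Set} → (X → ℕ) → List X → ℕ
  sumL f []       = 0
  sumL f (x ∷ xs) = f x ℕ.+ sumL f xs

  -- a subset A ⊆ F^d is given by its (decidable) indicator function;
  -- |A| is its cardinality
  size : ∀ {d} → (Vec Carrier d → Bool) → ℕ
  size {d} A = countL A (allVecs d)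

  Λ₄ : ∀ {d} → (Vec Carrier d → Bool) → ℕ
  Λ₄ {d} A =
    sumL (λ x₁ → sumL (λ x₂ → sumL (λ x₃ → countL (λ x₄ →
      A x₁ ∧ A x₂ ∧ A x₃ ∧ A x₄ ∧ does ((x₁ +ᵛ x₂) ≟ᵛ (x₃ +ᵛ x₄))) vs) vs) vs) vs
    where vs = allVecs d

open FiniteField public using (Carrier; card)

module _ (K₀ K : FiniteField) where
  private
    module K₀ = FiniteField K₀
    module K  = FiniteField K

  record IsFpLinearIso {d : ℕ} (ψ : Carrier K₀ × Carrier K₀ → Vec (Carrier K) d) : Set where
    field
      additive : ∀ a b c e → ψ (a K₀.+ c , b K₀.+ e) ≡ (ψ (a , b) K.+ᵛ ψ (c , e))
      scalar   : ∀ (k : ℕ) a b → ψ (k K₀.· a , k K₀.· b) ≡ (k K.·ᵛ ψ (a , b))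
      inv      : Vec (Carrier K) d → Carrier K₀ × Carrier K₀
      inv∘ψ    : ∀ u → inv (ψ u) ≡ u
      ψ∘inv    : ∀ v → ψ (inv v) ≡ v

  parabolaImage : {d : ℕ} → (Carrier K₀ × Carrier K₀ → Vec (Carrier K) d) →
                  Vec (Carrier K) d → Bool
  parabolaImage ψ x = any (λ t → does (ψ (t , t K₀.* t) K.≟ᵛ x)) K₀.elems

-- The parabola {(t, t²)} in F_{q₀}² is a Sidon set because q₀ is odd: if t₁ + t₂ = t₃ + t₄ and
-- t₁² + t₂² = t₃² + t₄², then 2 t₁ t₂ = 2 t₃ t₄, hence (t₃ - t₁)(t₃ - t₂) = 0 and t₃ ∈ {t₁, t₂}.
-- The additive bijection ψ transports this to U, so in Λ₄(U) each pair (x₁, x₂) ∈ U² admits at most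
-- two choices of x₃, each fixing x₄; summing gives Λ₄(U) ≤ 2|U|². Injectivity of t ↦ ψ(t, t²)
-- gives |U| = q₀, and 2 ≠ 0 in F_{q₀} because x ↦ x + 1 would otherwise pair off its q₀ elements.

module Submission where

open import Defs
open import Data.Nat as Nat using (ℕ; zero; suc; _≤_; z≤n; s≤s)
open import Data.Nat.Properties
  using (≤-refl; ≤-trans; ≤-reflexive; ≤-antisym; n≤1+n; m≤n+m; m≤m+n; +-suc; +-mono-≤; *-monoʳ-≤;
         *-identityˡ; *-comm; *-suc; *-zeroʳ; *-distribˡ-+; even≢odd; module ≤-Reasoning)
open import Data.Nat.Primality using (Prime; prime⇒irreducible)
open import Data.Nat.Divisibility using (divides)
open import Data.Nat.Tactic.RingSolver using (solve-∀)
open import Data.Bool using (Bool; true; false; T; _∧_; _∨_; if_then_else_)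
open import Data.Bool.Properties using (T-≡; T-∧)
open import Data.Bool.ListAction using (any)
open import Data.Product using (_×_; _,_; proj₁; ∃)
open import Data.Product.Properties using (,-injective)
open import Data.Sum as Sum using (_⊎_; inj₁; inj₂)
open import Data.Empty using (⊥-elim)
open import Data.List using (List; []; _∷_; length; map; concatMap; filter; cartesianProductWith; _++_)
open import Data.List.Properties using (filter-accept; filter-reject; filter-all)
open import Data.List.Membership.Propositional using (_∈_; find)
open import Data.List.Membership.Propositional.Properties
  using (∈-filter⁺; ∈-filter⁻; ∈-cartesianProductWith⁺)
open import Data.List.Relation.Unary.All as All using (All)
open import Data.List.Relation.Unary.Any using (here; there)
open import Data.List.Relation.Unary.Any.Properties using (any⁻)
open import Data.List.Relation.Unary.Unique.Propositional using (Unique; []; _∷_)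
import Data.List.Relation.Unary.Unique.Propositional.Properties as Unique
open import Data.Vec using (Vec; []; _∷_)
open import Data.Vec.Properties using (∷-injective)
open import Function using (_∘_; Injective; Equivalence)
open import Relation.Nullary using (¬_; Dec; yes; no; does; ¬?)
open import Relation.Nullary.Decidable using (dec-true)
open import Relation.Binary.Definitions using (DecidableEquality)
open import Relation.Binary.PropositionalEquality
open import Algebra.Bundles using (CommutativeRing)
open import Algebra.Structures using (IsCommutativeRing)

T-does : {P : Set} (P? : Dec P) → T (does P?) → P
T-does (yes p) _ = p

module Parity where
  open Nat using (_+_; _*_; _^_)

  Even Odd : ℕ → Set
  Even n = ∃ λ k → n ≡ 2 * k
  Odd  n = ∃ λ k → n ≡ suc (2 * k)

  even⊎odd : ∀ n → Even n ⊎ Odd n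
  even⊎odd zero = inj₁ (0 , refl)
  even⊎odd (suc n) with even⊎odd n
  ... | inj₁ (k , n≡2k)   = inj₂ (k , cong suc n≡2k)
  ... | inj₂ (k , n≡2k+1) = inj₁ (suc k , trans (cong suc n≡2k+1) (sym (*-suc 2 k)))

  odd-* : ∀ {m n} → Odd m → Odd n → Odd (m * n)
  odd-* (j , refl) (k , refl) = j + k + 2 * j * k , expand j k
    where
    expand : ∀ j k → suc (2 * j) * suc (2 * k) ≡ suc (2 * (j + k + 2 * j * k))
    expand = solve-∀

  odd-^ : ∀ {m} → Odd m → ∀ e → Odd (m ^ e)
  odd-^ odd zero    = 0 , refl
  odd-^ odd (suc e) = odd-* odd (odd-^ odd e)

  odd-prime : ∀ {p} → Prime p → p ≢ 2 → Odd p
  odd-prime {p} p-prime p≢2 with even⊎odd p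
  ... | inj₂ odd = odd
  ... | inj₁ (k , p≡2k) with prime⇒irreducible p-prime (divides k (trans p≡2k (*-comm 2 k)))
  ...   | inj₁ ()
  ...   | inj₂ 2≡p = ⊥-elim (p≢2 (sym 2≡p))

  module _ {X : Set} (_≟_ : DecidableEquality X) {f : X → X}
           (f-involutive : ∀ x → f (f x) ≡ x) (f-fixed-point-free : ∀ x → f x ≢ x) where

    private
      _≢?_ : (y a : X) → Dec (y ≢ a)
      y ≢? a = ¬? (y ≟ a)

      without : X → List X → List X
      without a = filter (_≢? a)

      length-without : ∀ {a xs} → Unique xs → a ∈ xs → length xs ≡ suc (length (without a xs))
      length-without {xs = x ∷ xs} (x∉xs ∷ _) (here refl) = cong (suc ∘ length) (sym (begin
        without x (x ∷ xs) ≡⟨ filter-reject (_≢? x) (λ x≢x → x≢x refl) ⟩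
        without x xs       ≡⟨ filter-all (_≢? x) (All.map (λ x≢y y≡x → x≢y (sym y≡x)) x∉xs) ⟩
        xs                 ∎))
        where open ≡-Reasoning
      length-without {a} {x ∷ xs} (x∉xs ∷ xs!) (there a∈xs) = cong suc (begin
        length xs                      ≡⟨ length-without xs! a∈xs ⟩
        suc (length (without a xs))    ≡⟨ cong length (filter-accept (_≢? a) (All.lookup x∉xs a∈xs)) ⟨
        length (without a (x ∷ xs))    ∎)
        where open ≡-Reasoning

    involution-closed⇒even-length : ∀ xs → Unique xs → (∀ {x} → x ∈ xs → f x ∈ xs) → Even (length xs)
    involution-closed⇒even-length xs = go (length xs) xs ≤-refl
      where
      go : ∀ n xs → length xs ≤ n → Unique xs → (∀ {x} → x ∈ xs → f x ∈ xs) → Even (length xs)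
      go _       []       _            _            _      = 0 , refl
      go (suc n) (x ∷ xs) (s≤s |xs|≤n) (x∉xs ∷ xs!) closed =
        let k , |rest|≡2k = go n rest |rest|≤n (Unique.filter⁺ (_≢? f x) xs!) rest-closed
        in  suc k , trans (cong suc |xs|≡1+|rest|) (trans (cong (suc ∘ suc) |rest|≡2k) (sym (*-suc 2 k)))
        where
        fx∈xs : f x ∈ xs
        fx∈xs with closed (here refl)
        ... | here fx≡x = ⊥-elim (f-fixed-point-free x fx≡x)
        ... | there fx∈xs = fx∈xs
        rest = without (f x) xs
        |xs|≡1+|rest| = length-without xs! fx∈xs
        |rest|≤n : length rest ≤ n
        |rest|≤n = ≤-trans (n≤1+n _) (subst (_≤ n) |xs|≡1+|rest| |xs|≤n)
        rest-closed : ∀ {y} → y ∈ rest → f y ∈ rest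
        rest-closed {y} y∈rest with ∈-filter⁻ (_≢? f x) y∈rest
        ... | y∈xs , y≢fx = ∈-filter⁺ (_≢? f x) fy∈xs fy≢fx
          where
          fy≢fx : f y ≢ f x
          fy≢fx fy≡fx = All.lookup x∉xs y∈xs
            (trans (sym (f-involutive x)) (trans (cong f (sym fy≡fx)) (f-involutive y)))
          fy∈xs : f y ∈ xs
          fy∈xs with closed (there y∈xs)
          ... | here fy≡x = ⊥-elim (y≢fx (trans (sym (f-involutive y)) (cong f fy≡x)))
          ... | there fy∈xs = fy∈xs

open Parity

module Counting (K : FiniteField) where
  open Nat using (_+_; _*_)
  open FiniteField K using (countL; sumL)

  𝟙 : Bool → ℕ
  𝟙 b = if b then 1 else 0

  module _ {X : Set} where

    sumL-𝟙 : ∀ (P : X → Bool) xs → sumL (𝟙 ∘ P) xs ≡ countL P xs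
    sumL-𝟙 P []       = refl
    sumL-𝟙 P (x ∷ xs) = cong (𝟙 (P x) +_) (sumL-𝟙 P xs)

    sumL-cong : ∀ {f g : X → ℕ} xs → (∀ x → f x ≡ g x) → sumL f xs ≡ sumL g xs
    sumL-cong []       _    = refl
    sumL-cong (x ∷ xs) f≡g = cong₂ _+_ (f≡g x) (sumL-cong xs f≡g)

    sumL-mono : ∀ {f g : X → ℕ} xs → (∀ x → f x ≤ g x) → sumL f xs ≤ sumL g xs
    sumL-mono []       _    = z≤n
    sumL-mono (x ∷ xs) f≤g = +-mono-≤ (f≤g x) (sumL-mono xs f≤g)

    sumL-+ : ∀ (f g : X → ℕ) xs → sumL (λ x → f x + g x) xs ≡ sumL f xs + sumL g xs
    sumL-+ f g []       = refl
    sumL-+ f g (x ∷ xs) = trans (cong (f x + g x +_) (sumL-+ f g xs)) (interchange (f x) (g x) (sumL f xs) (sumL g xs))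
      where
      interchange : ∀ a b c d → a + b + (c + d) ≡ a + c + (b + d)
      interchange = solve-∀

    sumL-*ˡ : ∀ c (f : X → ℕ) xs → sumL (λ x → c * f x) xs ≡ c * sumL f xs
    sumL-*ˡ c f []       = sym (*-zeroʳ c)
    sumL-*ˡ c f (x ∷ xs) = trans (cong (c * f x +_) (sumL-*ˡ c f xs)) (sym (*-distribˡ-+ c (f x) (sumL f xs)))

    sumL-*ʳ : ∀ c (f : X → ℕ) xs → sumL (λ x → f x * c) xs ≡ sumL f xs * c
    sumL-*ʳ c f xs = trans (sumL-cong xs (λ x → *-comm (f x) c)) (trans (sumL-*ˡ c f xs) (*-comm c _))

    countL-none : ∀ {P : X → Bool} xs → (∀ {x} → x ∈ xs → ¬ T (P x)) → countL P xs ≡ 0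
    countL-none     []       _  = refl
    countL-none {P} (x ∷ xs) ¬P with P x | ¬P (here refl)
    ... | true  | ¬Px = ⊥-elim (¬Px _)
    ... | false | _   = countL-none xs (¬P ∘ there)

    countL-≤1 : ∀ {P : X → Bool} {xs} → Unique xs → (∀ {y z} → T (P y) → T (P z) → y ≡ z) → countL P xs ≤ 1
    countL-≤1     {xs = []}     _            _        = z≤n
    countL-≤1 {P} {x ∷ xs}    (x∉xs ∷ xs!) P-unique with P x in Px
    ... | true  = ≤-reflexive (cong suc (countL-none xs λ y∈xs Py →
                    All.lookup x∉xs y∈xs (P-unique (Equivalence.from T-≡ Px) Py)))
    ... | false = countL-≤1 xs! P-unique

    countL-≥1 : ∀ {P : X → Bool} {a xs} → a ∈ xs → T (P a) → 1 ≤ countL P xs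
    countL-≥1 {P} {a} (here refl) Pa with P a
    ... | true = s≤s z≤n
    countL-≥1 {P} {xs = x ∷ xs} (there a∈xs) Pa = ≤-trans (countL-≥1 a∈xs Pa) (m≤n+m _ (𝟙 (P x)))

    countL-∨ : ∀ (P Q : X → Bool) xs → (∀ x → T (P x) → ¬ T (Q x)) →
               countL (λ x → P x ∨ Q x) xs ≡ countL P xs + countL Q xs
    countL-∨ P Q []       _        = refl
    countL-∨ P Q (x ∷ xs) disjoint with P x | Q x | disjoint x
    ... | true  | true  | P⇒¬Q = ⊥-elim (P⇒¬Q _ _)
    ... | true  | false | _    = cong suc (countL-∨ P Q xs disjoint)
    ... | false | true  | _    = trans (cong suc (countL-∨ P Q xs disjoint)) (sym (+-suc _ _))
    ... | false | false | _    = countL-∨ P Q xs disjoint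

    countL-≡1 : ∀ {P : X → Bool} {a xs} → Unique xs → a ∈ xs → T (P a) → (∀ {y} → T (P y) → y ≡ a) →
                countL P xs ≡ 1
    countL-≡1 xs! a∈xs Pa only-a =
      ≤-antisym (countL-≤1 xs! (λ Py Pz → trans (only-a Py) (sym (only-a Pz)))) (countL-≥1 a∈xs Pa)

  countL-image : ∀ {X Y : Set} (_≟_ : DecidableEquality X) {g : Y → X} → Injective _≡_ _≡_ g →
                 ∀ {xs} → Unique xs → (∀ x → x ∈ xs) →
                 ∀ ts → Unique ts → countL (λ x → any (λ t → does (g t ≟ x)) ts) xs ≡ length ts
  countL-image _≟_ g-injective {xs} xs! complete [] _ = countL-none xs (λ _ ())
  countL-image _≟_ {g} g-injective {xs} xs! complete (t ∷ ts) (t∉ts ∷ ts!) = begin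
    countL (λ x → hits-t x ∨ hits-ts x) xs       ≡⟨ countL-∨ hits-t hits-ts xs disjoint ⟩
    countL hits-t xs + countL hits-ts xs         ≡⟨ cong₂ _+_ hit-once (countL-image _≟_ g-injective xs! complete ts ts!) ⟩
    suc (length ts)                              ∎
    where
    open ≡-Reasoning
    hits-t hits-ts : _ → Bool
    hits-t  x = does (g t ≟ x)
    hits-ts x = any (λ t → does (g t ≟ x)) ts
    hit-once : countL hits-t xs ≡ 1
    hit-once = countL-≡1 xs! (complete (g t)) (Equivalence.from T-≡ (dec-true (g t ≟ g t) refl))
                         (sym ∘ T-does (g t ≟ _))
    disjoint : ∀ x → T (hits-t x) → ¬ T (hits-ts x)
    disjoint x gt≡x hit with find (any⁻ _ ts hit)
    ... | t′ , t′∈ts , gt′≡x =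
      All.lookup t∉ts t′∈ts (g-injective (trans (T-does (g t ≟ x) gt≡x) (sym (T-does (g t′ ≟ x) gt′≡x))))

module FieldProperties (K : FiniteField) where
  open FiniteField K hiding (Carrier; card)
  open IsCommutativeRing isCommutativeRing using (distribˡ; distribʳ; +-assoc; +-identityʳ)

  commutativeRing : CommutativeRing _ _
  commutativeRing = record { isCommutativeRing = isCommutativeRing }

  open CommutativeRing commutativeRing using (_-_; +-group)
  open import Algebra.Properties.Group +-group using (∙-cancelˡ; ∙-cancelʳ; //-rightDividesˡ; x∙y⁻¹≈ε⇒x≈y)
  open import Algebra.Solver.Ring.NaturalCoefficients.Default (CommutativeRing.commutativeSemiring commutativeRing)
  open ≡-Reasoning

  2# : Carrier K
  2# = 1# + 1#

  odd-card⇒2≢0 : Odd (card K) → 2# ≢ 0#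
  odd-card⇒2≢0 (l , card≡2l+1) 2≡0 =
    let k , card≡2k = involution-closed⇒even-length _≟_ +1-involutive +1-fixed-point-free
                        elems unique (λ {x} _ → complete (x + 1#))
    in  even≢odd k l (trans (sym card≡2k) card≡2l+1)
    where
    +1-involutive : ∀ x → (x + 1#) + 1# ≡ x
    +1-involutive x = trans (+-assoc x 1# 1#) (trans (cong (x +_) 2≡0) (+-identityʳ x))
    +1-fixed-point-free : ∀ x → x + 1# ≢ x
    +1-fixed-point-free x x+1≡x = 0≢1 (sym (∙-cancelˡ x 1# 0# (trans x+1≡x (sym (+-identityʳ x)))))

  *-cancelˡ : ∀ {u x y} → u ≢ 0# → u * x ≡ u * y → x ≡ y
  *-cancelˡ {u} {x} {y} u≢0 ux≡uy with inverse u u≢0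
  ... | w , uw≡1 = begin
    x                ≡⟨ solve 1 (λ x → x := con 1 :* x) refl x ⟩
    1# * x           ≡⟨ cong (_* x) uw≡1 ⟨
    (u * w) * x      ≡⟨ solve 3 (λ u w x → (u :* w) :* x := w :* (u :* x)) refl u w x ⟩
    w * (u * x)      ≡⟨ cong (w *_) ux≡uy ⟩
    w * (u * y)      ≡⟨ solve 3 (λ u w y → w :* (u :* y) := (u :* w) :* y) refl u w y ⟩
    (u * w) * y      ≡⟨ cong (_* y) uw≡1 ⟩
    1# * y           ≡⟨ solve 1 (λ y → con 1 :* y := y) refl y ⟩
    y                ∎

  x*y≡x*z⇒x≡0⊎y≡z : ∀ {x y z} → x * y ≡ x * z → x ≡ 0# ⊎ y ≡ z
  x*y≡x*z⇒x≡0⊎y≡z {x} xy≡xz with x ≟ 0#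
  ... | yes x≡0 = inj₁ x≡0
  ... | no  x≢0 = inj₂ (*-cancelˡ x≢0 xy≡xz)

  -- Once c d = a b, the chain below gives (c - a) c = (c - a) b, i.e. (c - a)(c - b) = 0.
  equal-power-sums⇒equal-pairs : 2# ≢ 0# → ∀ {a b c d} →
    c + d ≡ a + b → c * c + d * d ≡ a * a + b * b → c ≡ a ⊎ c ≡ b
  equal-power-sums⇒equal-pairs 2≢0 {a} {b} {c} {d} sums squares =
    Sum.map₁ (x∙y⁻¹≈ε⇒x≈y c a) (x*y≡x*z⇒x≡0⊎y≡z (∙-cancelʳ (a * c + a * b) _ _ (begin
      (c - a) * c + (a * c + a * b)    ≡⟨ +-assoc _ _ _ ⟨
      (c - a) * c + a * c + a * b      ≡⟨ cong (_+ a * b) (shift c) ⟩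
      c * c + a * b                    ≡⟨ cong (c * c +_) cd≡ab ⟨
      c * c + c * d                    ≡⟨ distribˡ c c d ⟨
      c * (c + d)                      ≡⟨ cong (c *_) sums ⟩
      c * (a + b)                      ≡⟨ solve 3 (λ a b c → c :* (a :+ b) := c :* b :+ a :* c) refl a b c ⟩
      c * b + a * c                    ≡⟨ cong (_+ a * c) (shift b) ⟨
      (c - a) * b + a * b + a * c      ≡⟨ solve 4 (λ u a b c → u :* b :+ a :* b :+ a :* c := u :* b :+ (a :* c :+ a :* b))
                                                  refl (c - a) a b c ⟩
      (c - a) * b + (a * c + a * b)    ∎)))
    where
    shift : ∀ x → (c - a) * x + a * x ≡ c * x
    shift x = trans (sym (distribʳ x (c - a) a)) (cong (_* x) (//-rightDividesˡ a c))
    square-expansion : ∀ x y → (x + y) * (x + y) ≡ (x * x + y * y) + 2# * (x * y)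
    square-expansion = solve 2 (λ x y → (x :+ y) :* (x :+ y) := (x :* x :+ y :* y) :+ (con 1 :+ con 1) :* (x :* y)) refl
    cd≡ab : c * d ≡ a * b
    cd≡ab = *-cancelˡ 2≢0 (∙-cancelˡ (c * c + d * d) _ _ (begin
      (c * c + d * d) + 2# * (c * d)   ≡⟨ square-expansion c d ⟨
      (c + d) * (c + d)                ≡⟨ cong (λ s → s * s) sums ⟩
      (a + b) * (a + b)                ≡⟨ square-expansion a b ⟩
      (a * a + b * b) + 2# * (a * b)   ≡⟨ cong (_+ 2# * (a * b)) squares ⟨
      (c * c + d * d) + 2# * (a * b)   ∎))

module VectorSpace (K : FiniteField) where
  open FiniteField K hiding (Carrier; card)
  open import Algebra.Properties.Group (CommutativeRing.+-group (FieldProperties.commutativeRing K))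
    using (∙-cancelˡ)

  +ᵛ-cancelˡ : ∀ {d} (u : Vec (Carrier K) d) {v w} → u +ᵛ v ≡ u +ᵛ w → v ≡ w
  +ᵛ-cancelˡ []      {[]}    {[]}    _   = refl
  +ᵛ-cancelˡ (a ∷ u) {b ∷ v} {c ∷ w} eq =
    let a+b≡a+c , u+v≡u+w = ∷-injective eq
    in  cong₂ _∷_ (∙-cancelˡ a b c a+b≡a+c) (+ᵛ-cancelˡ u u+v≡u+w)

  allVecs-suc : ∀ d → allVecs (suc d) ≡ cartesianProductWith _∷_ elems (allVecs d)
  allVecs-suc d = go elems
    where
    go : ∀ xs → concatMap (λ x → map (x ∷_) (allVecs d)) xs ≡ cartesianProductWith _∷_ xs (allVecs d)
    go []       = refl
    go (x ∷ xs) = cong (map (x ∷_) (allVecs d) ++_) (go xs)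

  allVecs-complete : ∀ d (v : Vec (Carrier K) d) → v ∈ allVecs d
  allVecs-complete zero    []      = here refl
  allVecs-complete (suc d) (x ∷ v) =
    subst (_ ∈_) (sym (allVecs-suc d)) (∈-cartesianProductWith⁺ _∷_ (complete x) (allVecs-complete d v))

  allVecs-unique : ∀ d → Unique (allVecs d)
  allVecs-unique zero    = All.[] ∷ []
  allVecs-unique (suc d) =
    subst Unique (sym (allVecs-suc d)) (Unique.cartesianProductWith⁺ _∷_ ∷-injective unique (allVecs-unique d))

open Nat using (_+_; _*_; _^_)

module Parabola (K₀ K : FiniteField) {d : ℕ} (ψ : Carrier K₀ × Carrier K₀ → Vec (Carrier K) d)
                (ψ-iso : IsFpLinearIso K₀ K ψ) where
  private
    module K₀ = FiniteField K₀
    module K  = FiniteField K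
  open IsFpLinearIso ψ-iso using (additive; inv; inv∘ψ)
  open Counting K
  open VectorSpace K using (+ᵛ-cancelˡ; allVecs-complete; allVecs-unique)
  open K using (_+ᵛ_; _≟ᵛ_; countL; sumL; size; Λ₄)

  U : Vec (Carrier K) d → Bool
  U = parabolaImage K₀ K ψ

  γ : Carrier K₀ → Vec (Carrier K) d
  γ t = ψ (t , t K₀.* t)

  vs : List (Vec (Carrier K) d)
  vs = K.allVecs d

  ψ-injective : Injective _≡_ _≡_ ψ
  ψ-injective {u} {w} ψu≡ψw = trans (sym (inv∘ψ u)) (trans (cong inv ψu≡ψw) (inv∘ψ w))

  γ-injective : Injective _≡_ _≡_ γ
  γ-injective = proj₁ ∘ ,-injective ∘ ψ-injective

  ∈U⇒∈γ : ∀ {x} → T (U x) → ∃ λ t → γ t ≡ x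
  ∈U⇒∈γ {x} x∈U = let t , _ , γt≡x = find (any⁻ _ K₀.elems x∈U) in t , T-does (γ t ≟ᵛ x) γt≡x

  size-U : size U ≡ card K₀
  size-U = countL-image _≟ᵛ_ γ-injective (allVecs-unique d) (allVecs-complete d) K₀.elems K₀.unique

  module _ (2≢0 : FieldProperties.2# K₀ ≢ K₀.0#) where

    U-sidon : ∀ {x₁ x₂ x₃ x₄} → T (U x₁) → T (U x₂) → T (U x₃) → T (U x₄) →
              x₁ +ᵛ x₂ ≡ x₃ +ᵛ x₄ → x₃ ≡ x₁ ⊎ x₃ ≡ x₂
    U-sidon x₁∈U x₂∈U x₃∈U x₄∈U x₁+x₂≡x₃+x₄ with ∈U⇒∈γ x₁∈U | ∈U⇒∈γ x₂∈U | ∈U⇒∈γ x₃∈U | ∈U⇒∈γ x₄∈U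
    ... | t₁ , refl | t₂ , refl | t₃ , refl | t₄ , refl =
      let sums , squares = ,-injective (ψ-injective (begin
            ψ (t₁ K₀.+ t₂ , t₁ K₀.* t₁ K₀.+ t₂ K₀.* t₂)   ≡⟨ additive _ _ _ _ ⟩
            γ t₁ +ᵛ γ t₂                                   ≡⟨ x₁+x₂≡x₃+x₄ ⟩
            γ t₃ +ᵛ γ t₄                                   ≡⟨ additive _ _ _ _ ⟨
            ψ (t₃ K₀.+ t₄ , t₃ K₀.* t₃ K₀.+ t₄ K₀.* t₄)   ∎))
      in  Sum.map (cong γ) (cong γ) (FieldProperties.equal-power-sums⇒equal-pairs K₀ 2≢0 (sym sums) (sym squares))
      where open ≡-Reasoning

    representations-≤ : ∀ x₁ x₂ x₃ →
      countL (λ x₄ → U x₁ ∧ U x₂ ∧ U x₃ ∧ U x₄ ∧ does ((x₁ +ᵛ x₂) ≟ᵛ (x₃ +ᵛ x₄))) vs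
        ≤ 𝟙 (U x₁) * (𝟙 (U x₂) * (𝟙 (does (x₃ ≟ᵛ x₁)) + 𝟙 (does (x₃ ≟ᵛ x₂))))
    representations-≤ x₁ x₂ x₃ with U x₁ in x₁∈U | U x₂ in x₂∈U
    ... | false | _     = ≤-reflexive (countL-none vs (λ _ ()))
    ... | true  | false = ≤-reflexive (countL-none vs (λ _ ()))
    ... | true  | true  =
      subst (countL P vs ≤_) (sym (trans (*-identityˡ _) (*-identityˡ _))) (by-cases (x₃ ≟ᵛ x₁) (x₃ ≟ᵛ x₂))
      where
      P : Vec (Carrier K) d → Bool
      P x₄ = U x₃ ∧ U x₄ ∧ does ((x₁ +ᵛ x₂) ≟ᵛ (x₃ +ᵛ x₄))
      solution : ∀ {x₄} → T (P x₄) → T (U x₃) × T (U x₄) × x₁ +ᵛ x₂ ≡ x₃ +ᵛ x₄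
      solution {x₄} Px₄ =
        let x₃∈U , rest = Equivalence.to T-∧ Px₄
            x₄∈U , sum  = Equivalence.to T-∧ rest
        in  x₃∈U , x₄∈U , T-does ((x₁ +ᵛ x₂) ≟ᵛ (x₃ +ᵛ x₄)) sum
      at-most-one : countL P vs ≤ 1
      at-most-one = countL-≤1 (allVecs-unique d) λ Py Pz →
        let _ , _ , y-sum = solution Py ; _ , _ , z-sum = solution Pz
        in  +ᵛ-cancelˡ x₃ (trans (sym y-sum) z-sum)
      by-cases : (x₃≟x₁ : Dec (x₃ ≡ x₁)) (x₃≟x₂ : Dec (x₃ ≡ x₂)) → countL P vs ≤ 𝟙 (does x₃≟x₁) + 𝟙 (does x₃≟x₂)
      by-cases (yes _)     _           = ≤-trans at-most-one (m≤m+n 1 _)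
      by-cases (no _)      (yes _)     = at-most-one
      by-cases (no x₃≢x₁) (no x₃≢x₂) = ≤-reflexive (countL-none vs λ _ Px₄ →
        let x₃∈U , x₄∈U , sum = solution Px₄
        in  Sum.[ x₃≢x₁ , x₃≢x₂ ] (U-sidon (Equivalence.from T-≡ x₁∈U) (Equivalence.from T-≡ x₂∈U) x₃∈U x₄∈U sum))

    sumL-≟-≤1 : ∀ a → sumL (λ x → 𝟙 (does (x ≟ᵛ a))) vs ≤ 1
    sumL-≟-≤1 a = subst (_≤ 1) (sym (sumL-𝟙 (λ x → does (x ≟ᵛ a)) vs))
      (countL-≤1 (allVecs-unique d) (λ y≡a z≡a → trans (T-does (_ ≟ᵛ a) y≡a) (sym (T-does (_ ≟ᵛ a) z≡a))))

    representations-≤2 : ∀ x₁ x₂ →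
      sumL (λ x₃ → countL (λ x₄ → U x₁ ∧ U x₂ ∧ U x₃ ∧ U x₄ ∧ does ((x₁ +ᵛ x₂) ≟ᵛ (x₃ +ᵛ x₄))) vs) vs
        ≤ 𝟙 (U x₁) * (𝟙 (U x₂) * 2)
    representations-≤2 x₁ x₂ = begin
      sumL (λ x₃ → countL _ vs) vs                 ≤⟨ sumL-mono vs (representations-≤ x₁ x₂) ⟩
      sumL (λ x₃ → a₁ * (a₂ * E x₃)) vs            ≡⟨ sumL-*ˡ a₁ _ vs ⟩
      a₁ * sumL (λ x₃ → a₂ * E x₃) vs              ≡⟨ cong (a₁ *_) (sumL-*ˡ a₂ E vs) ⟩
      a₁ * (a₂ * sumL E vs)                         ≡⟨ cong (λ s → a₁ * (a₂ * s)) (sumL-+ _ _ vs) ⟩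
      a₁ * (a₂ * (sumL _ vs + sumL _ vs))           ≤⟨ *-monoʳ-≤ a₁ (*-monoʳ-≤ a₂ (+-mono-≤ (sumL-≟-≤1 x₁) (sumL-≟-≤1 x₂))) ⟩
      a₁ * (a₂ * 2)                                 ∎
      where
      open ≤-Reasoning
      a₁ = 𝟙 (U x₁)
      a₂ = 𝟙 (U x₂)
      E : Vec (Carrier K) d → ℕ
      E x₃ = 𝟙 (does (x₃ ≟ᵛ x₁)) + 𝟙 (does (x₃ ≟ᵛ x₂))

    Λ₄-U-≤ : Λ₄ U ≤ 2 * size U ^ 2
    Λ₄-U-≤ = begin
      Λ₄ U                                    ≤⟨ sumL-mono vs (λ x₁ → sumL-mono vs (representations-≤2 x₁)) ⟩
      sumL (λ x₁ → sumL (λ x₂ → 𝟙 (U x₁) * (𝟙 (U x₂) * 2)) vs) vs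
                                              ≡⟨ sumL-cong vs (λ x₁ → trans (sumL-*ˡ (𝟙 (U x₁)) _ vs) (cong (𝟙 (U x₁) *_) (sumL-𝟙U-* 2))) ⟩
      sumL (λ x₁ → 𝟙 (U x₁) * (S * 2)) vs     ≡⟨ sumL-𝟙U-* (S * 2) ⟩
      S * (S * 2)                             ≡⟨ s*[s*2]≡2*s² S ⟩
      2 * S ^ 2                               ∎
      where
      open ≤-Reasoning
      S = size U
      sumL-𝟙U-* : ∀ c → sumL (λ x → 𝟙 (U x) * c) vs ≡ S * c
      sumL-𝟙U-* c = trans (sumL-*ʳ c (𝟙 ∘ U) vs) (cong (_* c) (sumL-𝟙 U vs))
      -- s ^ 2 unfolds to s * (s * 1), which the solver's own _^_ would not match.
      s*[s*2]≡2*s² : ∀ s → s * (s * 2) ≡ 2 * (s * (s * 1))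
      s*[s*2]≡2*s² = solve-∀

lemma3p5 : (p n d m : ℕ) → Prime p → p ≢ 2 → 1 ≤ n → 1 ≤ d → n * d ≡ 2 * m →
           (Fq Fq₀ : FiniteField) → card Fq ≡ p ^ n → card Fq₀ ≡ p ^ m →
           (ψ : Carrier Fq₀ × Carrier Fq₀ → Vec (Carrier Fq) d) → IsFpLinearIso Fq₀ Fq ψ →
           FiniteField.size Fq (parabolaImage Fq₀ Fq ψ) ≡ p ^ m
           × FiniteField.Λ₄ Fq (parabolaImage Fq₀ Fq ψ)
             ≤ 2 * (FiniteField.size Fq (parabolaImage Fq₀ Fq ψ) ^ 2)
lemma3p5 p _ _ m p-prime p≢2 _ _ _ Fq Fq₀ _ card-Fq₀ ψ ψ-iso = trans size-U card-Fq₀ , Λ₄-U-≤ 2≢0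
  where
  open Parabola Fq₀ Fq ψ ψ-iso
  2≢0 = FieldProperties.odd-card⇒2≢0 Fq₀ (subst Odd (sym card-Fq₀) (odd-^ (odd-prime p-prime p≢2) m))
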